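{- For every $X\subseteq\mathbb{N}$, the Boolean frame $\mathfrak{C}_X$ is subadditive, i.e. $g(x\sqcup y)\le g(x)\sqcup g(y)$ for all $x,y\subseteq\mathbb{N}$.
   Context: Let $E=\{2n:n\in\mathbb{N}\}$, $O=\{2n+1:n\in\mathbb{N}\}$, and let $E^*$ be the set of infinite $S\subseteq\mathbb{N}$ such that $S\cap O$ is finite and $E\setminus S$ is finite. For $n\in\mathbb{N}$ write $\overline{n}=\{n\}$ and $-\overline{n}=\mathbb{N}\setminus\{n\}$. For $X\subseteq\mathbb{N}$, $\mathfrak{C}_X=\langle\mathcal{P}(\mathbb{N}),g\rangle$ is the powerset Boolean algebra of $\mathbb{N}$ with $g$ defined for $S\subseteq\mathbb{N}$ by: $g(S)=\{0,\dots,n\}$ if $S=\{0,\dots,n-1\}$ for some $n\in\mathbb{N}$ (so $g(\emptyset)=\{0\}$); $g(S)=S$ if $S\in E^*$; $g(S)=-\overline{n}$ if $S=-\overline{n}$ and $n\in X$; $g(S)=S\cup\{\max(S)+1\}$ if $S$ is finite and $S\neq\{0,\dots,n-1\}$ for all $n\in\mathbb{N}$; and $g(S)=\mathbb{N}$ otherwise. -}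

module Defs where

open import Data.Nat using (ℕ; zero; suc; _+_; _*_; _≤_; _<_; _≥_)
open import Data.Bool using (Bool; true; false; _∨_)
open import Data.Product using (Σ; ∃; _×_; _,_)
open import Data.Sum using (_⊎_)
open import Relation.Nullary using (¬_)
open import Relation.Binary.PropositionalEquality using (_≡_; _≢_)
open import Function.Bundles using (_⇔_)

Subset : Set
Subset = ℕ → Bool

_∈_ : ℕ → Subset → Set
k ∈ S = S k ≡ true

_∪_ : Subset → Subset → Subset
(S ∪ T) k = S k ∨ T k

_⊆_ : Subset → Subset → Set
S ⊆ T = ∀ k → k ∈ S → k ∈ T

IsInitial : ℕ → Subset → Set
IsInitial n S = ∀ k → (k ∈ S) ⇔ (k < n)

IsCoSingleton : ℕ → Subset → Set
IsCoSingleton n S = ∀ k → (k ∈ S) ⇔ (k ≢ n)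

Finite : Subset → Set
Finite S = Σ ℕ λ N → ∀ k → k ∈ S → k < N

Infinite : Subset → Set
Infinite S = ¬ Finite S

Even Odd : ℕ → Set
Even k = Σ ℕ λ m → k ≡ 2 * m
Odd  k = Σ ℕ λ m → k ≡ 2 * m + 1

OddPartFinite : Subset → Set
OddPartFinite S = Σ ℕ λ N → ∀ k → k ∈ S → Odd k → k < N

EvenComplementFinite : Subset → Set
EvenComplementFinite S = Σ ℕ λ N → ∀ k → Even k → ¬ (k ∈ S) → k < N

InEstar : Subset → Set
InEstar S = Infinite S × OddPartFinite S × EvenComplementFinite S

IsMax : ℕ → Subset → Set
IsMax m S = m ∈ S × (∀ k → k ∈ S → k ≤ m)

-- Graph of the operator g of 𝔠_X :  G X S T  means  g(S) = T  (extensional equality).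
data G (X : Subset) (S T : Subset) : Set where
  g-initial : (n : ℕ) → IsInitial n S → IsInitial (suc n) T → G X S T
  g-estar   : InEstar S → (∀ k → (k ∈ T) ⇔ (k ∈ S)) → G X S T
  g-cosing  : (n : ℕ) → n ∈ X → IsCoSingleton n S → IsCoSingleton n T → G X S T
  g-finite  : Finite S → (∀ n → ¬ IsInitial n S) →
              (m : ℕ) → IsMax m S →
              (∀ k → (k ∈ T) ⇔ ((k ∈ S) ⊎ (k ≡ suc m))) → G X S T
  g-other   : (∀ n → ¬ IsInitial n S) → ¬ InEstar S →
              (∀ n → n ∈ X → ¬ IsCoSingleton n S) → ¬ Finite S →
              (∀ k → k ∈ T) → G X S T

{-# OPTIONS --safe #-}
module Submission where

open import Defs
open import Data.Nat using (zero; suc; _+_; z≤n; s≤s; _≟_)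
open import Data.Nat.Properties
  using ( ≤-antisym; <⇒≢; ≤⇒≯; n≮0; n<1+n; m<n⇒m<1+n; m<1+n⇒m<n∨m≡n; m<1+n⇒m≤n
        ; m≤m+n; m≤n+m; m≤n⇒m≤n+o; m≤n⇒m≤o+n )
open import Data.Bool using (true; false)
open import Data.Bool.Properties using (∨-zeroʳ) renaming (_≟_ to _≟ᵇ_)
open import Data.Product using (_×_; _,_)
open import Data.Sum using (_⊎_; inj₁; inj₂; [_,_])
open import Data.Empty using (⊥-elim)
open import Function using (_∘_)
open import Function.Bundles using (mk⇔; Equivalence)
open import Relation.Nullary using (¬_; Dec; yes; no; contradiction)
open import Relation.Binary.PropositionalEquality using (_≡_; refl; sym; cong)

open Equivalence using (to; from)

-- g is extensive, so x ∪ y ⊆ g(x) ∪ g(y).  Apart from the last clause, g(x ∪ y) adds to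
-- x ∪ y at most max(x ∪ y) + 1 (or 0 when x ∪ y = ∅); that maximum is also the maximum
-- of x or of y, and g adds its successor there as well.  In the last clause g(x ∪ y) = ℕ:
-- a point k ∉ x ∪ y that lies in neither g(x) nor g(y) forces each of x, y to be finite,
-- in E*, or ℕ ∖ {k} with k ∈ X; these cases are closed under union, which would put
-- x ∪ y into an earlier clause.

_∈?_ : ∀ k S → Dec (k ∈ S)
k ∈? S = S k ≟ᵇ true

⊆-∪ˡ : ∀ x y → x ⊆ (x ∪ y)
⊆-∪ˡ x y k k∈x rewrite k∈x = refl

⊆-∪ʳ : ∀ x y → y ⊆ (x ∪ y)
⊆-∪ʳ x y k k∈y rewrite k∈y = ∨-zeroʳ (x k)

∈-∪⁻ : ∀ (x y : Subset) k → k ∈ (x ∪ y) → k ∈ x ⊎ k ∈ y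
∈-∪⁻ x y k k∈x∪y with x k
... | true  = inj₁ refl
... | false = inj₂ k∈x∪y

∪-mono-⊆ : ∀ {x y b c : Subset} → x ⊆ b → y ⊆ c → (x ∪ y) ⊆ (b ∪ c)
∪-mono-⊆ {x} {y} {b} {c} x⊆b y⊆c k k∈x∪y =
  [ ⊆-∪ˡ b c k ∘ x⊆b k , ⊆-∪ʳ b c k ∘ y⊆c k ] (∈-∪⁻ x y k k∈x∪y)

Finite-∪ : ∀ {x y} → Finite x → Finite y → Finite (x ∪ y)
Finite-∪ {x} {y} (N₁ , x<N₁) (N₂ , y<N₂) = N₁ + N₂ , λ k k∈x∪y →
  [ m≤n⇒m≤n+o N₂ ∘ x<N₁ k , m≤n⇒m≤o+n N₁ ∘ y<N₂ k ] (∈-∪⁻ x y k k∈x∪y)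

OddPartFinite-∪ : ∀ {x y} → OddPartFinite x → OddPartFinite y → OddPartFinite (x ∪ y)
OddPartFinite-∪ {x} {y} (N₁ , x<N₁) (N₂ , y<N₂) = N₁ + N₂ , λ k k∈x∪y odd →
  [ (λ k∈x → m≤n⇒m≤n+o N₂ (x<N₁ k k∈x odd)) , (λ k∈y → m≤n⇒m≤o+n N₁ (y<N₂ k k∈y odd)) ]
    (∈-∪⁻ x y k k∈x∪y)

Infinite-mono : ∀ {x y} → x ⊆ y → Infinite x → Infinite y
Infinite-mono x⊆y x-inf (N , y<N) = x-inf (N , λ k → y<N k ∘ x⊆y k)

EvenComplementFinite-mono : ∀ {x y} → x ⊆ y → EvenComplementFinite x → EvenComplementFinite y
EvenComplementFinite-mono x⊆y (N , <N) = N , λ k even k∉y → <N k even (k∉y ∘ x⊆y k)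

Finite⇒OddPartFinite : ∀ {x} → Finite x → OddPartFinite x
Finite⇒OddPartFinite (N , x<N) = N , λ k k∈x _ → x<N k k∈x

InEstar-∪ˡ : ∀ {x y} → InEstar x → OddPartFinite y → InEstar (x ∪ y)
InEstar-∪ˡ (x-inf , x-odd , x-even) y-odd =
  Infinite-mono (⊆-∪ˡ _ _) x-inf , OddPartFinite-∪ x-odd y-odd ,
  EvenComplementFinite-mono (⊆-∪ˡ _ _) x-even

InEstar-∪ʳ : ∀ {x y} → OddPartFinite x → InEstar y → InEstar (x ∪ y)
InEstar-∪ʳ x-odd (y-inf , y-odd , y-even) =
  Infinite-mono (⊆-∪ʳ _ _) y-inf , OddPartFinite-∪ x-odd y-odd ,
  EvenComplementFinite-mono (⊆-∪ʳ _ _) y-even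

FiniteOrEstar-∪ : ∀ {x y} → Finite x ⊎ InEstar x → Finite y ⊎ InEstar y →
                  Finite (x ∪ y) ⊎ InEstar (x ∪ y)
FiniteOrEstar-∪ (inj₁ x-fin) (inj₁ y-fin) = inj₁ (Finite-∪ x-fin y-fin)
FiniteOrEstar-∪ (inj₁ x-fin) (inj₂ y-E*)  = inj₂ (InEstar-∪ʳ (Finite⇒OddPartFinite x-fin) y-E*)
FiniteOrEstar-∪ (inj₂ x-E*)  (inj₁ y-fin) = inj₂ (InEstar-∪ˡ x-E* (Finite⇒OddPartFinite y-fin))
FiniteOrEstar-∪ (inj₂ (_ , x-odd , _)) (inj₂ y-E*) = inj₂ (InEstar-∪ʳ x-odd y-E*)

IsCoSingleton-mono : ∀ {n x y} → x ⊆ y → ¬ n ∈ y → IsCoSingleton n x → IsCoSingleton n y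
IsCoSingleton-mono x⊆y n∉y cos k =
  mk⇔ (λ { k∈y refl → n∉y k∈y }) (λ k≢n → x⊆y k (from (cos k) k≢n))

IsCoSingleton⇒Infinite : ∀ {n S} → IsCoSingleton n S → Infinite S
IsCoSingleton⇒Infinite {n} {S} cos (N , S<N) = ≤⇒≯ (m≤m+n N (suc n)) (S<N k k∈S)
  where
  k = N + suc n
  k∈S : k ∈ S
  k∈S = from (cos k) (λ k≡n → <⇒≢ (m≤n+m (suc n) N) (sym k≡n))

IsMax⇒Finite : ∀ {m S} → IsMax m S → Finite S
IsMax⇒Finite {m} (_ , ≤m) = suc m , λ k k∈S → s≤s (≤m k k∈S)

IsMax-unique : ∀ {m m′ S} → IsMax m S → IsMax m′ S → m ≡ m′
IsMax-unique (m∈S , ≤m) (m′∈S , ≤m′) = ≤-antisym (≤m′ _ m∈S) (≤m _ m′∈S)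

IsMax-∪ : ∀ {m} x y → IsMax m (x ∪ y) → IsMax m x ⊎ IsMax m y
IsMax-∪ x y (m∈x∪y , ≤m) with ∈-∪⁻ x y _ m∈x∪y
... | inj₁ m∈x = inj₁ (m∈x , λ k → ≤m k ∘ ⊆-∪ˡ x y k)
... | inj₂ m∈y = inj₂ (m∈y , λ k → ≤m k ∘ ⊆-∪ʳ x y k)

IsInitial-suc⇒IsMax : ∀ {m S} → IsInitial (suc m) S → IsMax m S
IsInitial-suc⇒IsMax {m} ini = from (ini m) (n<1+n m) , λ k → m<1+n⇒m≤n ∘ to (ini k)

IsInitial⇒Finite : ∀ {n S} → IsInitial n S → Finite S
IsInitial⇒Finite {n} ini = n , λ k → to (ini k)

Empty⇒Finite : ∀ {S} → (∀ k → ¬ k ∈ S) → Finite S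
Empty⇒Finite S-empty = 0 , λ k k∈S → contradiction k∈S (S-empty k)

g-extensive : ∀ {X S T} → G X S T → S ⊆ T
g-extensive (g-initial _ ini ini′)   k k∈S = from (ini′ k) (m<n⇒m<1+n (to (ini k) k∈S))
g-extensive (g-estar _ T≈S)          k k∈S = from (T≈S k) k∈S
g-extensive (g-cosing _ _ cos cos′)  k k∈S = from (cos′ k) (to (cos k) k∈S)
g-extensive (g-finite _ _ _ _ T≈)    k k∈S = from (T≈ k) (inj₁ k∈S)
g-extensive (g-other _ _ _ _ T-full) k _   = T-full k

g-suc-max : ∀ {X S T m} → G X S T → IsMax m S → suc m ∈ T
g-suc-max (g-initial _ ini ini′) (m∈S , _) = from (ini′ _) (s≤s (to (ini _) m∈S))
g-suc-max (g-estar (S-inf , _) _) max      = contradiction (IsMax⇒Finite max) S-inf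
g-suc-max (g-cosing _ _ cos _) max         = contradiction (IsMax⇒Finite max) (IsCoSingleton⇒Infinite cos)
g-suc-max (g-finite _ _ _ max′ T≈) max     = from (T≈ _) (inj₂ (cong suc (IsMax-unique max max′)))
g-suc-max (g-other _ _ _ _ T-full) _       = T-full _

g-empty : ∀ {X S T} → G X S T → (∀ k → ¬ k ∈ S) → 0 ∈ T
g-empty (g-initial zero _ ini′) _              = from (ini′ 0) (s≤s z≤n)
g-empty (g-initial (suc _) ini _) S-empty      = contradiction (from (ini 0) (s≤s z≤n)) (S-empty 0)
g-empty (g-estar (S-inf , _) _) S-empty        = contradiction (Empty⇒Finite S-empty) S-inf
g-empty (g-cosing _ _ cos _) S-empty           = contradiction (Empty⇒Finite S-empty) (IsCoSingleton⇒Infinite cos)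
g-empty (g-finite _ _ m (m∈S , _) _) S-empty   = contradiction m∈S (S-empty m)
g-empty (g-other _ _ _ _ T-full) _             = T-full 0

g-missing : ∀ {X S T k} → G X S T → ¬ k ∈ S →
            k ∈ T ⊎ (k ∈ X × IsCoSingleton k S) ⊎ Finite S ⊎ InEstar S
g-missing (g-initial _ ini _) _ = inj₂ (inj₂ (inj₁ (IsInitial⇒Finite ini)))
g-missing (g-estar S-E* _) _    = inj₂ (inj₂ (inj₂ S-E*))
g-missing {k = k} (g-cosing n n∈X cos _) k∉S with k ≟ n
... | yes refl = inj₂ (inj₁ (n∈X , cos))
... | no k≢n   = contradiction (from (cos k) k≢n) k∉S
g-missing (g-finite S-fin _ _ _ _) _ = inj₂ (inj₂ (inj₁ S-fin))
g-missing (g-other _ _ _ _ T-full) _ = inj₁ (T-full _)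

module _ {X x y b c} (gx : G X x b) (gy : G X y c) where

  ∪-extensive : (x ∪ y) ⊆ (b ∪ c)
  ∪-extensive = ∪-mono-⊆ (g-extensive gx) (g-extensive gy)

  suc-max-∈-∪ : ∀ {m} → IsMax m (x ∪ y) → suc m ∈ (b ∪ c)
  suc-max-∈-∪ max with IsMax-∪ x y max
  ... | inj₁ max-x = ⊆-∪ˡ b c _ (g-suc-max gx max-x)
  ... | inj₂ max-y = ⊆-∪ʳ b c _ (g-suc-max gy max-y)

  initial-bound-∈-∪ : ∀ {n} → IsInitial n (x ∪ y) → n ∈ (b ∪ c)
  initial-bound-∈-∪ {zero}  ini = ⊆-∪ˡ b c 0 (g-empty gx (λ k → n≮0 ∘ to (ini k) ∘ ⊆-∪ˡ x y k))
  initial-bound-∈-∪ {suc m} ini = suc-max-∈-∪ (IsInitial-suc⇒IsMax ini)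

  all-∈-∪ : (∀ n → n ∈ X → ¬ IsCoSingleton n (x ∪ y)) → ¬ Finite (x ∪ y) → ¬ InEstar (x ∪ y) →
            ∀ k → k ∈ (b ∪ c)
  all-∈-∪ ¬cos ¬fin ¬E* k with k ∈? (x ∪ y)
  ... | yes k∈x∪y = ∪-extensive k k∈x∪y
  ... | no  k∉x∪y = cover (g-missing gx (k∉x∪y ∘ ⊆-∪ˡ x y k)) (g-missing gy (k∉x∪y ∘ ⊆-∪ʳ x y k))
    where
    cover : k ∈ b ⊎ (k ∈ X × IsCoSingleton k x) ⊎ Finite x ⊎ InEstar x →
            k ∈ c ⊎ (k ∈ X × IsCoSingleton k y) ⊎ Finite y ⊎ InEstar y → k ∈ (b ∪ c)
    cover (inj₁ k∈b) _ = ⊆-∪ˡ b c k k∈b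
    cover _ (inj₁ k∈c) = ⊆-∪ʳ b c k k∈c
    cover (inj₂ (inj₁ (k∈X , cos))) _ =
      contradiction (IsCoSingleton-mono (⊆-∪ˡ x y) k∉x∪y cos) (¬cos k k∈X)
    cover _ (inj₂ (inj₁ (k∈X , cos))) =
      contradiction (IsCoSingleton-mono (⊆-∪ʳ x y) k∉x∪y cos) (¬cos k k∈X)
    cover (inj₂ (inj₂ x-small)) (inj₂ (inj₂ y-small)) =
      ⊥-elim ([ ¬fin , ¬E* ] (FiniteOrEstar-∪ x-small y-small))

proposition2p7 : (X x y a b c : Subset) →
    G X (x ∪ y) a → G X x b → G X y c → a ⊆ (b ∪ c)
proposition2p7 X x y a b c (g-initial n ini ini′) gx gy k k∈a with m<1+n⇒m<n∨m≡n (to (ini′ k) k∈a)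
... | inj₁ k<n  = ∪-extensive gx gy k (from (ini k) k<n)
... | inj₂ refl = initial-bound-∈-∪ gx gy ini
proposition2p7 X x y a b c (g-estar _ a≈) gx gy k k∈a = ∪-extensive gx gy k (to (a≈ k) k∈a)
proposition2p7 X x y a b c (g-cosing _ _ cos cos′) gx gy k k∈a =
  ∪-extensive gx gy k (from (cos k) (to (cos′ k) k∈a))
proposition2p7 X x y a b c (g-finite _ _ _ max a≈) gx gy k k∈a with to (a≈ k) k∈a
... | inj₁ k∈x∪y = ∪-extensive gx gy k k∈x∪y
... | inj₂ refl  = suc-max-∈-∪ gx gy max
proposition2p7 X x y a b c (g-other _ ¬E* ¬cos ¬fin _) gx gy k _ = all-∈-∪ gx gy ¬cos ¬fin ¬E* k
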